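{- Let $A$ be a finite set and $C$ a relationally defined permutation clone on $A$. If $f,g\in B(A)$ and $f\oplus g\in C$, then $f\in C$ and $g\in C$.
   Context: $B_n(A)=\mathrm{Sym}(A^n)$, $B(A)=\bigcup_n B_n(A)$; $f\oplus g$ applies $f\in B_n(A)$ to the first $n$ and $g\in B_m(A)$ to the last $m$ coordinates of $A^{n+m}$. For a relation $R\subseteq A^k$, $\mathrm{PPol}(R)$ is the set of $f\in B_n(A)$ ($n\in\mathbb{N}$) such that for every $k\times n$ array with all columns in $R$, applying $f$ to each row yields an array with all columns in $R$. A relationally defined permutation clone is one of the form $\mathrm{PPol}(R)$ for a relation $R$ on $A$. -}

module Defs where

open import Level using () renaming (suc to lsuc)
open import Data.Nat using (ℕ; zero; suc; _+_)
open import Data.Fin using (Fin)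
open import Data.Vec using (Vec; []; _∷_; _++_; take; drop; lookup; map)
open import Data.Vec.Properties using (take++drop≡id)
open import Data.Product using (Σ; _×_; _,_; proj₁; proj₂)
open import Function using (_∘_)
open import Function.Bundles using (_↔_; Inverse; mk↔ₛ′)
open import Relation.Binary.PropositionalEquality using (_≡_; refl; cong; cong₂)

Bn : ∀ {a} (A : Set a) → ℕ → Set a
Bn A n = Vec A n ↔ Vec A n

B : ∀ {a} (A : Set a) → Set a
B A = Σ ℕ (Bn A)

private
  take-++ : ∀ {a} {A : Set a} n {m} (xs : Vec A n) (ys : Vec A m) → take n (xs ++ ys) ≡ xs
  take-++ zero [] ys = refl
  take-++ (suc n) (x ∷ xs) ys = cong (x ∷_) (take-++ n xs ys)

  drop-++ : ∀ {a} {A : Set a} n {m} (xs : Vec A n) (ys : Vec A m) → drop n (xs ++ ys) ≡ ys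
  drop-++ zero [] ys = refl
  drop-++ (suc n) (x ∷ xs) ys = drop-++ n xs ys

⊕fun : ∀ {a} {A : Set a} {n m} → (Vec A n → Vec A n) → (Vec A m → Vec A m) →
       Vec A (n + m) → Vec A (n + m)
⊕fun {n = n} f g v = f (take n v) ++ g (drop n v)

private
  ⊕inv : ∀ {a} {A : Set a} {n m} (f f' : Vec A n → Vec A n) (g g' : Vec A m → Vec A m) →
         (∀ x → f (f' x) ≡ x) → (∀ x → g (g' x) ≡ x) →
         ∀ v → ⊕fun f g (⊕fun f' g' v) ≡ v
  ⊕inv {n = n} f f' g g' pf pg v
    rewrite take-++ n (f' (take n v)) (g' (drop n v))
          | drop-++ n (f' (take n v)) (g' (drop n v))
          | pf (take n v) | pg (drop n v) = take++drop≡id n v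

_⊕_ : ∀ {a} {A : Set a} {n m} → Bn A n → Bn A m → Bn A (n + m)
f ⊕ g = mk↔ₛ′ (⊕fun (Inverse.to f) (Inverse.to g)) (⊕fun (Inverse.from f) (Inverse.from g))
  (⊕inv (Inverse.to f) (Inverse.from f) (Inverse.to g) (Inverse.from g)
        (Inverse.strictlyInverseˡ f) (Inverse.strictlyInverseˡ g))
  (⊕inv (Inverse.from f) (Inverse.to f) (Inverse.from g) (Inverse.to g)
        (Inverse.strictlyInverseʳ f) (Inverse.strictlyInverseʳ g))

Rel : ∀ {a} (A : Set a) → ℕ → Set _
Rel {a} A k = Vec A k → Set a

-- A k × n array, given as its k rows (each an element of A^n).
Array : ∀ {a} (A : Set a) → ℕ → ℕ → Set a
Array A k n = Vec (Vec A n) k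

column : ∀ {a} {A : Set a} {k n} → Array A k n → Fin n → Vec A k
column M j = map (λ row → lookup row j) M

ColumnsIn : ∀ {a} {A : Set a} {k n} → Rel A k → Array A k n → Set a
ColumnsIn R M = ∀ j → R (column M j)

PPol : ∀ {a} {A : Set a} {k} → Rel A k → B A → Set a
PPol {A = A} {k} R (n , f) =
  (M : Array A k n) → ColumnsIn R M → ColumnsIn R (map (Inverse.to f) M)

-- C (a set of elements of B(A)) is a relationally defined permutation clone:
-- C = PPol(R) for some relation R on A (extensionally, as predicates on B(A)).
RelDefPermClone : ∀ {a} (A : Set a) → (B A → Set a) → Set (lsuc a)
RelDefPermClone A C = Σ ℕ λ k → Σ (Rel A k) λ R → ∀ h → (C h → PPol R h) × (PPol R h → C h)

{-# OPTIONS --safe #-}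
-- To test f against R on an array M at column j, pad every row of M with m
-- copies of its j-th entry.  All new columns equal column j, so the padded
-- array still has its columns in R, and column j of its image under f ⊕ g is
-- column j of the image of M under f.  Symmetrically for g, padding on the
-- left.
module Submission where

open import Level using (Level)
open import Defs
open import Data.Nat using (ℕ; _+_)
open import Data.Fin using (Fin; splitAt; _↑ˡ_; _↑ʳ_)
open import Data.Fin.Properties using (splitAt⁻¹-↑ˡ; splitAt⁻¹-↑ʳ)
open import Data.Product using (_×_; _,_; proj₁; proj₂)
open import Data.Sum using (inj₁; inj₂)
open import Data.Vec using (Vec; []; _∷_; _++_; take; drop; map; replicate; zipWith)
open import Data.Vec.Properties
  using (take++drop≡id; ++-injective; lookup-++ˡ; lookup-++ʳ; lookup-replicate)
open import Function.Bundles using (Inverse)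
open import Relation.Binary.PropositionalEquality using (_≡_; refl; cong; cong₂; subst; sym; trans)

private
  variable
    a : Level
    A : Set a
    k n m : ℕ

take-drop-++ : (xs : Vec A n) (ys : Vec A m) →
               take n (xs ++ ys) ≡ xs × drop n (xs ++ ys) ≡ ys
take-drop-++ {n = n} xs ys = ++-injective (take n (xs ++ ys)) xs (take++drop≡id n (xs ++ ys))

⊕-++ : (f : Bn A n) (g : Bn A m) (xs : Vec A n) (ys : Vec A m) →
       Inverse.to (f ⊕ g) (xs ++ ys) ≡ Inverse.to f xs ++ Inverse.to g ys
⊕-++ f g xs ys with take-drop-++ xs ys
... | take≡xs , drop≡ys = cong₂ (λ u v → Inverse.to f u ++ Inverse.to g v) take≡xs drop≡ys

juxtapose : Array A k n → Array A k m → Array A k (n + m)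
juxtapose = zipWith _++_

repeatColumn : ∀ m → Vec A k → Array A k m
repeatColumn m = map (replicate m)

column-juxtaposeˡ : (P : Array A k n) (Q : Array A k m) (i : Fin n) →
                    column (juxtapose P Q) (i ↑ˡ m) ≡ column P i
column-juxtaposeˡ []      []      i = refl
column-juxtaposeˡ (x ∷ P) (y ∷ Q) i = cong₂ _∷_ (lookup-++ˡ x y i) (column-juxtaposeˡ P Q i)

column-juxtaposeʳ : (P : Array A k n) (Q : Array A k m) (i : Fin m) →
                    column (juxtapose P Q) (n ↑ʳ i) ≡ column Q i
column-juxtaposeʳ []      []      i = refl
column-juxtaposeʳ (x ∷ P) (y ∷ Q) i = cong₂ _∷_ (lookup-++ʳ x y i) (column-juxtaposeʳ P Q i)

column-repeatColumn : (c : Vec A k) (i : Fin m) → column (repeatColumn m c) i ≡ c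
column-repeatColumn []      i = refl
column-repeatColumn (x ∷ c) i = cong₂ _∷_ (lookup-replicate i x) (column-repeatColumn c i)

map-⊕-juxtapose : (f : Bn A n) (g : Bn A m) (P : Array A k n) (Q : Array A k m) →
                  map (Inverse.to (f ⊕ g)) (juxtapose P Q)
                    ≡ juxtapose (map (Inverse.to f) P) (map (Inverse.to g) Q)
map-⊕-juxtapose f g []      []      = refl
map-⊕-juxtapose f g (x ∷ P) (y ∷ Q) = cong₂ _∷_ (⊕-++ f g x y) (map-⊕-juxtapose f g P Q)

module _ (R : Rel A k) where

  ColumnsIn-juxtapose : {P : Array A k n} {Q : Array A k m} →
                        ColumnsIn R P → ColumnsIn R Q → ColumnsIn R (juxtapose P Q)
  ColumnsIn-juxtapose {n = n} {m = m} {P} {Q} P∈R Q∈R i with splitAt n i in eq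
  ... | inj₁ j = subst (λ i → R (column (juxtapose P Q) i)) (splitAt⁻¹-↑ˡ eq)
                   (subst R (sym (column-juxtaposeˡ P Q j)) (P∈R j))
  ... | inj₂ j = subst (λ i → R (column (juxtapose P Q) i)) (splitAt⁻¹-↑ʳ eq)
                   (subst R (sym (column-juxtaposeʳ P Q j)) (Q∈R j))

  ColumnsIn-repeatColumn : {c : Vec A k} → R c → ColumnsIn R (repeatColumn m c)
  ColumnsIn-repeatColumn {c = c} c∈R i = subst R (sym (column-repeatColumn c i)) c∈R

  PPol-⊕ˡ : (f : Bn A n) (g : Bn A m) → PPol R (n + m , f ⊕ g) → PPol R (n , f)
  PPol-⊕ˡ {m = m} f g f⊕g∈PPol M M∈R j =
    subst R (trans (cong (λ X → column X (j ↑ˡ m)) (map-⊕-juxtapose f g M N))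
                   (column-juxtaposeˡ _ _ j))
          (f⊕g∈PPol (juxtapose M N)
                    (ColumnsIn-juxtapose M∈R (ColumnsIn-repeatColumn (M∈R j)))
                    (j ↑ˡ m))
    where N = repeatColumn m (column M j)

  PPol-⊕ʳ : (f : Bn A n) (g : Bn A m) → PPol R (n + m , f ⊕ g) → PPol R (m , g)
  PPol-⊕ʳ {n = n} f g f⊕g∈PPol M M∈R j =
    subst R (trans (cong (λ X → column X (n ↑ʳ j)) (map-⊕-juxtapose f g N M))
                   (column-juxtaposeʳ _ _ j))
          (f⊕g∈PPol (juxtapose N M)
                    (ColumnsIn-juxtapose (ColumnsIn-repeatColumn (M∈R j)) M∈R)
                    (n ↑ʳ j))
    where N = repeatColumn n (column M j)

lemma6 : (s : ℕ) (C : B (Fin s) → Set) → RelDefPermClone (Fin s) C →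
         (n m : ℕ) (f : Bn (Fin s) n) (g : Bn (Fin s) m) →
         C (n + m , f ⊕ g) → C (n , f) × C (m , g)
lemma6 s C (k , R , C⇔PPol) n m f g f⊕g∈C =
  proj₂ (C⇔PPol (n , f)) (PPol-⊕ˡ R f g f⊕g∈PPol) , proj₂ (C⇔PPol (m , g)) (PPol-⊕ʳ R f g f⊕g∈PPol)
  where f⊕g∈PPol = proj₁ (C⇔PPol (n + m , f ⊕ g)) f⊕g∈C
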